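{- For nonnegative integers $m<n$, let $\Phi(m,n)$ denote the number of subsets $A$ of $\{m+1,m+2,\ldots,n\}$ such that $\gcd(A)$ is relatively prime to $n$. Then \[ \Phi(m,n)=\sum_{d\mid n}\mu(d)\,2^{(n/d)-[m/d]}. \] Moreover, if $n\ge 2$ and $p^{*}$ is the smallest prime divisor of $n$, then \[ 0\le 2^{n-m}-2^{(n/p^{*})-[m/p^{*}]}-\Phi(m,n)\le 2n\,2^{[(n-m)/(p^{*}+1)]}. \]
   Context: Here subsets include the empty set, with the convention $\gcd(\emptyset)=0$ (so the empty set is counted exactly when $n=1$). $\mu$ denotes the Möbius function, and the sum runs over positive divisors $d$ of $n$. For a real number $x$, $[x]$ denotes the greatest integer not exceeding $x$. -}

module Defs where

open import Data.Nat using (ℕ; zero; suc; _+_; _∸_; _*_; _/_; _≤_; NonZero)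
open import Data.Nat.GCD using (gcd)
open import Data.Nat.Divisibility using (_∣_; _∣?_)
open import Data.Nat.Coprimality using (coprime?)
open import Data.Nat.Primality using (prime?)
open import Data.Integer as ℤ using (ℤ)
open import Data.List using (List; []; _∷_; _++_; map; filter; length; foldr; upTo)
open import Data.Bool.ListAction using (any)
open import Relation.Nullary.Decidable using (⌊_⌋; does)
open import Data.Bool using (if_then_else_)

subsets : List ℕ → List (List ℕ)
subsets []       = [] ∷ []
subsets (x ∷ xs) = subsets xs ++ map (x ∷_) (subsets xs)

-- gcd of a finite set, with gcd(∅) = 0
gcdList : List ℕ → ℕ
gcdList = foldr gcd 0

interval : ℕ → ℕ → List ℕ
interval m n = map (λ k → suc (m + k)) (upTo (n ∸ m))

Φ : ℕ → ℕ → ℕ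
Φ m n = length (filter (λ A → coprime? (gcdList A) n) (subsets (interval m n)))

squarefree : ℕ → Data.Bool.Bool
squarefree d = Data.Bool.not (any (λ j → ⌊ (suc (suc j) * suc (suc j)) ∣? d ⌋) (upTo d))

ω : ℕ → ℕ
ω d = length (filter (λ j → prime? (suc j)) (filter (λ j → suc j ∣? d) (upTo d)))

μ : ℕ → ℤ
μ d = if squarefree d then (ℤ.- ℤ.1ℤ) ℤ.^ ω d else ℤ.0ℤ

sumDiv : ℕ → ((d : ℕ) → .{{NonZero d}} → ℤ) → ℤ
sumDiv n f = foldr ℤ._+_ ℤ.0ℤ (map (λ k → f (suc k)) (filter (λ k → suc k ∣? n) (upTo n)))

module Submission where

-- For one subset, Möbius inversion gives [gcd(gcd A, n) = 1] = Σ_{d ∣ n} μ d · [d ∣ gcd A];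
-- the divisor-sum identity Σ_{d ∣ k} μ d = [k = 1] is proved by pairing, for a prime p ∣ k, each
-- divisor e with p ∤ e against p·e, using μ (p·e) = - μ e.  Summing over A and exchanging the sums,
-- the coefficient of μ d is #{A : d ∣ gcd A} = 2 ^ #{multiples of d in (m, n]} = 2 ^ (n/d - m/d).
--
-- Let Ψ = 2 ^ (n - m) - Φ count the remaining subsets and p be the least prime divisor
-- of n.  Subsets inside the multiples of p are counted by Ψ, so Ψ ≥ 2 ^ (n/p - m/p).  Conversely
-- a subset counted by Ψ has gcd divisible by p or by a prime q ∣ n with q > p; the latter subsets
-- number at most 2 ^ (n/q - m/q) ≤ 2 ^ (1 + (n - m)/(p + 1)) for each of the at most n values of q.

open import Defs

open import Algebra.Bundles using (Semiring)
open import Data.Bool using (true; false; not; if_then_else_)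
open import Data.Bool.Properties using (T-≡; not-injective)
open import Data.Empty using (⊥-elim)
open import Data.List using (List; []; _∷_; _++_; [_]; map; filter; foldr; length; upTo)
open import Data.List.Properties using (upTo-∷ʳ; length-++; length-map; length-upTo)
open import Data.List.Membership.Propositional using (_∈_; lose)
open import Data.List.Membership.Propositional.Properties using (∈-upTo⁻; ∈-upTo⁺)
open import Data.List.Relation.Unary.All using (_∷_)
open import Data.List.Relation.Unary.Any using (here; there; satisfied)
open import Data.List.Relation.Unary.Any.Properties using (any⁺; any⁻)
open import Data.Nat as ℕ using (ℕ; zero; suc; _≤_; _<_; z≤n; s≤s; NonZero)
import Data.Nat.Properties as ℕP
open import Data.Nat.Coprimality as Coprimality
  using (Coprime; coprime?; coprime-divisor; coprime⇒gcd≡1; gcd≡1⇒coprime)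
open import Data.Nat.Divisibility
  using (_∣_; _∣?_; divides; ∣⇒≤; ∣m+n∣m⇒∣n; m∣m*n; n∣m*n; ∣-refl; ∣-trans; ∣n⇒∣m*n; *-pres-∣; *-monoʳ-∣; *-cancelˡ-∣)
open import Data.Nat.DivMod
  using (m≡m%n+[m/n]*n; m%n<n; +-distrib-/-∣ʳ; +-distrib-/-∣ˡ; m<n⇒m/n≡0; m*n/n≡m; n/n≡1; /-monoˡ-≤; /-monoʳ-≤)
open import Data.Nat.GCD using (gcd; gcd[m,n]∣m; gcd[m,n]∣n; gcd-greatest; gcd[m,n]≡0⇒m≡0; gcd[m,n]≡0⇒n≡0)
open import Data.Nat.Primality
  using (Prime; prime?; prime⇒nonZero; prime⇒nonTrivial; prime⇒irreducible; euclidsLemma)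
open import Data.Nat.Primality.Factorisation using (factorise)
open import Data.Integer as ℤ using (ℤ)
import Data.Integer.Properties as ℤP
open import Data.Integer.Tactic.RingSolver using (solve-∀)
open import Data.Product using (_×_; _,_; ∃-syntax)
open import Data.Sum using (inj₁; inj₂)
open import Function.Bundles using (Equivalence)
open import Relation.Nullary using (Dec; yes; no; ¬_)
open import Relation.Nullary.Decidable using (toWitness; fromWitness; ¬?; _×-dec_)
open import Relation.Unary using (Pred; Decidable)
open import Relation.Binary.PropositionalEquality as ≡ using (_≡_)

module Sums {a ℓ} (R : Semiring a ℓ) where

  open Semiring R
  open import Relation.Binary.Reasoning.Setoid setoid
  open import Algebra.Properties.CommutativeSemigroup +-commutativeSemigroup using (interchange)

  ∑ : {A : Set} → List A → (A → Carrier) → Carrier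
  ∑ []       f = 0#
  ∑ (x ∷ xs) f = f x + ∑ xs f

  when : {P : Set} → Dec P → Carrier → Carrier
  when (yes _) x = x
  when (no _)  _ = 0#

  when-yes : {P : Set} (D : Dec P) {x : Carrier} → P → when D x ≡ x
  when-yes (yes _) _ = ≡.refl
  when-yes (no ¬p) p = ⊥-elim (¬p p)

  when-no : {P : Set} (D : Dec P) {x : Carrier} → ¬ P → when D x ≡ 0#
  when-no (yes p) ¬p = ⊥-elim (¬p p)
  when-no (no _)  _  = ≡.refl

  when-split : {P : Set} (D : Dec P) (x : Carrier) → x ≈ when D x + when (¬? D) x
  when-split (yes _) x = sym (+-identityʳ x)
  when-split (no _)  x = sym (+-identityˡ x)

  when-0 : {P : Set} (D : Dec P) → when D 0# ≡ 0#
  when-0 (yes _) = ≡.refl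
  when-0 (no _)  = ≡.refl

  when-⇔ : {P Q : Set} (P? : Dec P) (Q? : Dec Q) {x : Carrier} → (P → Q) → (Q → P) → when P? x ≡ when Q? x
  when-⇔ (yes p) Q? p→q q→p = ≡.sym (when-yes Q? (p→q p))
  when-⇔ (no ¬p) Q? p→q q→p = ≡.sym (when-no Q? (λ q → ¬p (q→p q)))

  when-∣-gcd : ∀ d x y (c : Carrier) → when (d ∣? x) (when (d ∣? y) c) ≡ when (d ∣? gcd x y) c
  when-∣-gcd d x y c with d ∣? x | d ∣? y | d ∣? gcd x y
  ... | yes d∣x | yes d∣y | no  d∤g = ⊥-elim (d∤g (gcd-greatest d∣x d∣y))
  ... | no  d∤x | _       | yes d∣g = ⊥-elim (d∤x (∣-trans d∣g (gcd[m,n]∣m x y)))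
  ... | yes _   | no  d∤y | yes d∣g = ⊥-elim (d∤y (∣-trans d∣g (gcd[m,n]∣n x y)))
  ... | yes _   | yes _   | yes _   = ≡.refl
  ... | yes _   | no  _   | no  _   = ≡.refl
  ... | no  _   | _       | no  _   = ≡.refl

  when-∣-beyond : ∀ {k} j → 1 ≤ k → k ≤ j → {x : Carrier} → when (suc j ∣? k) x ≡ 0#
  when-∣-beyond {k} j k≥1 k≤j =
    when-no (suc j ∣? k) (λ j+1∣k → ℕP.<⇒≱ (s≤s k≤j) (∣⇒≤ {{ℕ.>-nonZero k≥1}} j+1∣k))

  module _ {A : Set} where

    ∑-cong : (xs : List A) {f g : A → Carrier} → (∀ x → f x ≈ g x) → ∑ xs f ≈ ∑ xs g
    ∑-cong []       f≈g = refl
    ∑-cong (x ∷ xs) f≈g = +-cong (f≈g x) (∑-cong xs f≈g)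

    ∑-zero : (xs : List A) {f : A → Carrier} → (∀ x → x ∈ xs → f x ≈ 0#) → ∑ xs f ≈ 0#
    ∑-zero []       f≈0 = refl
    ∑-zero (x ∷ xs) f≈0 = begin
      _ + _ ≈⟨ +-cong (f≈0 x (here ≡.refl)) (∑-zero xs (λ y y∈xs → f≈0 y (there y∈xs))) ⟩
      0# + 0# ≈⟨ +-identityˡ 0# ⟩
      0# ∎

    ∑-++ : (xs ys : List A) (f : A → Carrier) → ∑ (xs ++ ys) f ≈ ∑ xs f + ∑ ys f
    ∑-++ []       ys f = sym (+-identityˡ _)
    ∑-++ (x ∷ xs) ys f = trans (+-congˡ (∑-++ xs ys f)) (sym (+-assoc (f x) _ _))

    ∑-+ : (xs : List A) (f g : A → Carrier) → ∑ xs (λ x → f x + g x) ≈ ∑ xs f + ∑ xs g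
    ∑-+ []       f g = sym (+-identityˡ 0#)
    ∑-+ (x ∷ xs) f g = trans (+-congˡ (∑-+ xs f g)) (interchange (f x) (g x) _ _)

    ∑-*ˡ : (xs : List A) (c : Carrier) (f : A → Carrier) → ∑ xs (λ x → c * f x) ≈ c * ∑ xs f
    ∑-*ˡ []       c f = sym (zeroʳ c)
    ∑-*ˡ (x ∷ xs) c f = trans (+-congˡ (∑-*ˡ xs c f)) (sym (distribˡ c (f x) _))

    ∑-when : {P : Set} (D : Dec P) (xs : List A) (f : A → Carrier) →
             ∑ xs (λ x → when D (f x)) ≈ when D (∑ xs f)
    ∑-when (yes _) xs f = refl
    ∑-when (no _)  xs f = ∑-zero xs (λ _ _ → refl)

  ∑-swap : {A B : Set} (xs : List A) (ys : List B) (f : A → B → Carrier) →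
           ∑ xs (λ x → ∑ ys (f x)) ≈ ∑ ys (λ y → ∑ xs (λ x → f x y))
  ∑-swap []       ys f = sym (∑-zero ys (λ _ _ → refl))
  ∑-swap (x ∷ xs) ys f =
    trans (+-congˡ (∑-swap xs ys f)) (sym (∑-+ ys (f x) (λ y → ∑ xs (λ x′ → f x′ y))))

  ∑-map : {A B : Set} (g : A → B) (xs : List A) (f : B → Carrier) → ∑ (map g xs) f ≡ ∑ xs (λ x → f (g x))
  ∑-map g []       f = ≡.refl
  ∑-map g (x ∷ xs) f = ≡.cong (f (g x) +_) (∑-map g xs f)

  ∑-filter : {A : Set} {P : Pred A _} (P? : Decidable P) (xs : List A) (f : A → Carrier) →
             ∑ (filter P? xs) f ≈ ∑ xs (λ x → when (P? x) (f x))
  ∑-filter P? []       f = refl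
  ∑-filter P? (x ∷ xs) f with P? x
  ... | yes _ = +-congˡ (∑-filter P? xs f)
  ... | no  _ = trans (∑-filter P? xs f) (sym (+-identityˡ _))

  foldr-map≡∑ : {A : Set} (g : A → Carrier) (xs : List A) → foldr _+_ 0# (map g xs) ≡ ∑ xs g
  foldr-map≡∑ g []       = ≡.refl
  foldr-map≡∑ g (x ∷ xs) = ≡.cong (g x +_) (foldr-map≡∑ g xs)

  ∑-upTo-suc : ∀ n (f : ℕ → Carrier) → ∑ (upTo (suc n)) f ≈ ∑ (upTo n) f + f n
  ∑-upTo-suc n f = begin
    ∑ (upTo (suc n)) f       ≡⟨ ≡.cong (λ l → ∑ l f) (≡.sym (upTo-∷ʳ n)) ⟩
    ∑ (upTo n ++ [ n ]) f    ≈⟨ ∑-++ (upTo n) [ n ] f ⟩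
    ∑ (upTo n) f + (f n + 0#) ≈⟨ +-congˡ (+-identityʳ (f n)) ⟩
    ∑ (upTo n) f + f n       ∎

  ∑-upTo-+ : ∀ m n (f : ℕ → Carrier) → ∑ (upTo (m ℕ.+ n)) f ≈ ∑ (upTo m) f + ∑ (upTo n) (λ t → f (m ℕ.+ t))
  ∑-upTo-+ m zero    f = begin
    ∑ (upTo (m ℕ.+ 0)) f ≡⟨ ≡.cong (λ k → ∑ (upTo k) f) (ℕP.+-identityʳ m) ⟩
    ∑ (upTo m) f        ≈⟨ sym (+-identityʳ _) ⟩
    ∑ (upTo m) f + 0#   ∎
  ∑-upTo-+ m (suc n) f = begin
    ∑ (upTo (m ℕ.+ suc n)) f ≡⟨ ≡.cong (λ k → ∑ (upTo k) f) (ℕP.+-suc m n) ⟩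
    ∑ (upTo (suc (m ℕ.+ n))) f ≈⟨ ∑-upTo-suc (m ℕ.+ n) f ⟩
    ∑ (upTo (m ℕ.+ n)) f + f (m ℕ.+ n) ≈⟨ +-congʳ (∑-upTo-+ m n f) ⟩
    (∑ (upTo m) f + ∑ (upTo n) g) + g n ≈⟨ +-assoc _ _ _ ⟩
    ∑ (upTo m) f + (∑ (upTo n) g + g n) ≈⟨ +-congˡ (sym (∑-upTo-suc n g)) ⟩
    ∑ (upTo m) f + ∑ (upTo (suc n)) g ∎
    where g = λ t → f (m ℕ.+ t)

  ∑-upTo-extend : ∀ {m n} (f : ℕ → Carrier) → m ≤ n → (∀ j → m ≤ j → f j ≈ 0#) → ∑ (upTo n) f ≈ ∑ (upTo m) f
  ∑-upTo-extend {m} {n} f m≤n f≈0 = begin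
    ∑ (upTo n) f ≡⟨ ≡.cong (λ k → ∑ (upTo k) f) (≡.sym (ℕP.m+[n∸m]≡n m≤n)) ⟩
    ∑ (upTo (m ℕ.+ (n ℕ.∸ m))) f ≈⟨ ∑-upTo-+ m (n ℕ.∸ m) f ⟩
    ∑ (upTo m) f + ∑ (upTo (n ℕ.∸ m)) (λ t → f (m ℕ.+ t)) ≈⟨ +-congˡ (∑-zero (upTo (n ℕ.∸ m)) (λ t _ → f≈0 (m ℕ.+ t) (ℕP.m≤m+n m t))) ⟩
    ∑ (upTo m) f + 0# ≈⟨ +-identityʳ _ ⟩
    ∑ (upTo m) f ∎

  -- in a block of q consecutive numbers q·i+1, ..., q·i+q only the last is a multiple of q
  ∑-block : ∀ q i (F : ℕ → Carrier) → .{{_ : ℕ.NonZero q}} →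
            ∑ (upTo q) (λ t → when (q ∣? suc (q ℕ.* i ℕ.+ t)) (F (suc (q ℕ.* i ℕ.+ t)))) ≈ F (q ℕ.* suc i)
  ∑-block (suc q′) i F = begin
    ∑ (upTo (suc q′)) G ≈⟨ ∑-upTo-suc q′ G ⟩
    ∑ (upTo q′) G + G q′ ≈⟨ +-congʳ (∑-zero (upTo q′) (λ t t∈ → G<q′ t (∈-upTo⁻ t∈))) ⟩
    0# + G q′ ≈⟨ +-identityˡ _ ⟩
    G q′ ≡⟨ ≡.cong (λ x → when (q ∣? x) (F x)) last ⟩
    when (q ∣? q ℕ.* suc i) (F (q ℕ.* suc i)) ≡⟨ when-yes (q ∣? q ℕ.* suc i) (m∣m*n (suc i)) ⟩
    F (q ℕ.* suc i) ∎
    where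
    q = suc q′
    G = λ t → when (q ∣? suc (q ℕ.* i ℕ.+ t)) (F (suc (q ℕ.* i ℕ.+ t)))
    last : suc (q ℕ.* i ℕ.+ q′) ≡ q ℕ.* suc i
    last = ≡.trans (≡.cong suc (ℕP.+-comm (q ℕ.* i) q′)) (≡.sym (ℕP.*-suc q i))
    G<q′ : ∀ t → t < q′ → G t ≈ 0#
    G<q′ t t<q′ with q ∣? suc (q ℕ.* i ℕ.+ t)
    ... | no _  = refl
    ... | yes q∣ = ⊥-elim (ℕP.<⇒≱ (s≤s t<q′) (∣⇒≤ (∣m+n∣m⇒∣n (≡.subst (q ∣_) (≡.sym (ℕP.+-suc (q ℕ.* i) t)) q∣) (m∣m*n i))))

  ∑-multiples : ∀ q M (F : ℕ → Carrier) → .{{_ : ℕ.NonZero q}} →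
                ∑ (upTo (q ℕ.* M)) (λ j → when (q ∣? suc j) (F (suc j))) ≈ ∑ (upTo M) (λ i → F (q ℕ.* suc i))
  ∑-multiples q zero    F = reflexive (≡.cong (λ k → ∑ (upTo k) (λ j → when (q ∣? suc j) (F (suc j)))) (ℕP.*-zeroʳ q))
  ∑-multiples q (suc M) F = begin
    ∑ (upTo (q ℕ.* suc M)) H ≡⟨ ≡.cong (λ k → ∑ (upTo k) H) (≡.trans (ℕP.*-suc q M) (ℕP.+-comm q (q ℕ.* M))) ⟩
    ∑ (upTo (q ℕ.* M ℕ.+ q)) H ≈⟨ ∑-upTo-+ (q ℕ.* M) q H ⟩
    ∑ (upTo (q ℕ.* M)) H + ∑ (upTo q) (λ t → H (q ℕ.* M ℕ.+ t)) ≈⟨ +-cong (∑-multiples q M F) (∑-block q M F) ⟩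
    ∑ (upTo M) (λ i → F (q ℕ.* suc i)) + F (q ℕ.* suc M) ≈⟨ sym (∑-upTo-suc M _) ⟩
    ∑ (upTo (suc M)) (λ i → F (q ℕ.* suc i)) ∎
    where H = λ j → when (q ∣? suc j) (F (suc j))

open import Data.Nat using (_+_; _*_; _∸_; _^_; _/_; _%_)
open ≡ using (refl; cong; cong₂; sym; trans; subst; module ≡-Reasoning)

module ℕΣ = Sums ℕP.+-*-semiring

𝟙 : {P : Set} → Dec P → ℕ
𝟙 D = ℕΣ.when D 1

length-filter≡∑ : {A : Set} {P : Pred A _} (P? : Decidable P) (xs : List A) →
                  length (filter P? xs) ≡ ℕΣ.∑ xs (λ x → 𝟙 (P? x))
length-filter≡∑ P? xs = begin
  length (filter P? xs)         ≡⟨ length≡∑ (filter P? xs) ⟩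
  ℕΣ.∑ (filter P? xs) (λ _ → 1) ≡⟨ ℕΣ.∑-filter P? xs (λ _ → 1) ⟩
  ℕΣ.∑ xs (λ x → 𝟙 (P? x))      ∎
  where
  open ≡-Reasoning
  length≡∑ : {A : Set} (ys : List A) → length ys ≡ ℕΣ.∑ ys (λ _ → 1)
  length≡∑ []       = refl
  length≡∑ (y ∷ ys) = cong suc (length≡∑ ys)

length-subsets : (L : List ℕ) → length (subsets L) ≡ 2 ^ length L
length-subsets []       = refl
length-subsets (x ∷ xs) = begin
  length (subsets xs ++ map (x ∷_) (subsets xs))   ≡⟨ length-++ (subsets xs) ⟩
  length (subsets xs) + length (map (x ∷_) (subsets xs)) ≡⟨ cong (length (subsets xs) +_) (length-map (x ∷_) (subsets xs)) ⟩
  length (subsets xs) + length (subsets xs)         ≡⟨ cong (λ k → k + k) (length-subsets xs) ⟩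
  2 ^ length xs + 2 ^ length xs                     ≡⟨ cong (2 ^ length xs +_) (ℕP.+-identityʳ _) ⟨
  2 ^ length (x ∷ xs) ∎
  where open ≡-Reasoning

-- #{A ⊆ L : d ∣ gcd A} = 2 ^ #{x ∈ L : d ∣ x}: such A are exactly the subsets of the multiples of d in L
count-divisible-subsets : ∀ d (L : List ℕ) →
  ℕΣ.∑ (subsets L) (λ A → 𝟙 (d ∣? gcdList A)) ≡ 2 ^ length (filter (d ∣?_) L)
count-divisible-subsets d [] = cong (_+ 0) (ℕΣ.when-yes (d ∣? 0) (divides 0 refl))
count-divisible-subsets d (x ∷ xs) = begin
  ℕΣ.∑ (subsets xs ++ map (x ∷_) (subsets xs)) f
    ≡⟨ ℕΣ.∑-++ (subsets xs) (map (x ∷_) (subsets xs)) f ⟩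
  ℕΣ.∑ (subsets xs) f + ℕΣ.∑ (map (x ∷_) (subsets xs)) f
    ≡⟨ cong (ℕΣ.∑ (subsets xs) f +_) (ℕΣ.∑-map (x ∷_) (subsets xs) f) ⟩
  ℕΣ.∑ (subsets xs) f + ℕΣ.∑ (subsets xs) (λ A → 𝟙 (d ∣? gcd x (gcdList A)))
    ≡⟨ cong (ℕΣ.∑ (subsets xs) f +_) (ℕΣ.∑-cong (subsets xs) (λ A → sym (ℕΣ.when-∣-gcd d x (gcdList A) 1))) ⟩
  ℕΣ.∑ (subsets xs) f + ℕΣ.∑ (subsets xs) (λ A → ℕΣ.when (d ∣? x) (f A))
    ≡⟨ cong (ℕΣ.∑ (subsets xs) f +_) (ℕΣ.∑-when (d ∣? x) (subsets xs) f) ⟩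
  ℕΣ.∑ (subsets xs) f + ℕΣ.when (d ∣? x) (ℕΣ.∑ (subsets xs) f)
    ≡⟨ cong (λ c → c + ℕΣ.when (d ∣? x) c) (count-divisible-subsets d xs) ⟩
  2 ^ length (filter (d ∣?_) xs) + ℕΣ.when (d ∣? x) (2 ^ length (filter (d ∣?_) xs))
    ≡⟨ doubling ⟩
  2 ^ length (filter (d ∣?_) (x ∷ xs)) ∎
  where
  open ≡-Reasoning
  f = λ A → 𝟙 (d ∣? gcdList A)
  doubling : 2 ^ length (filter (d ∣?_) xs) + ℕΣ.when (d ∣? x) (2 ^ length (filter (d ∣?_) xs))
             ≡ 2 ^ length (filter (d ∣?_) (x ∷ xs))
  doubling with d ∣? x
  ... | yes _ = cong (2 ^ length (filter (d ∣?_) xs) +_) (sym (ℕP.+-identityʳ _))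
  ... | no  _ = ℕP.+-identityʳ _

[r+q*d]/d≡q : ∀ {r} q d .{{_ : NonZero d}} → r < d → (r + q * d) / d ≡ q
[r+q*d]/d≡q {r} q d r<d = trans (+-distrib-/-∣ʳ r (divides q refl)) (cong₂ _+_ (m<n⇒m/n≡0 r<d) (m*n/n≡m q d))

suc-/ : ∀ x d .{{_ : NonZero d}} → suc x / d ≡ x / d + 𝟙 (d ∣? suc x)
suc-/ x d = subst (λ y → suc y / d ≡ y / d + 𝟙 (d ∣? suc y)) (sym (m≡m%n+[m/n]*n x d))
                  (step (x % d) (x / d) (m%n<n x d))
  where
  step : ∀ r q → r < d → suc (r + q * d) / d ≡ (r + q * d) / d + 𝟙 (d ∣? suc (r + q * d))
  step r q r<d with suc r ℕ.≟ d
  ... | yes refl = begin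
    suc (r + q * d) / d ≡⟨ m*n/n≡m (suc q) d ⟩
    suc q              ≡⟨ ℕP.+-comm 1 q ⟩
    q + 1              ≡⟨ cong₂ _+_ ([r+q*d]/d≡q q d r<d) (ℕΣ.when-yes (d ∣? suc (r + q * d)) (divides (suc q) refl)) ⟨
    (r + q * d) / d + 𝟙 (d ∣? suc (r + q * d)) ∎
    where open ≡-Reasoning
  ... | no 1+r≢d = begin
    suc (r + q * d) / d ≡⟨ [r+q*d]/d≡q q d 1+r<d ⟩
    q                  ≡⟨ ℕP.+-identityʳ q ⟨
    q + 0              ≡⟨ cong₂ _+_ ([r+q*d]/d≡q q d r<d) (ℕΣ.when-no (d ∣? suc (r + q * d)) d∤) ⟨
    (r + q * d) / d + 𝟙 (d ∣? suc (r + q * d)) ∎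
    where
    open ≡-Reasoning
    1+r<d : suc r < d
    1+r<d = ℕP.≤∧≢⇒< r<d 1+r≢d
    d∤ : ¬ d ∣ suc r + q * d
    d∤ d∣ = ℕP.<⇒≱ 1+r<d (∣⇒≤ (∣m+n∣m⇒∣n (subst (d ∣_) (ℕP.+-comm (suc r) (q * d)) d∣) (divides q refl)))

count-multiples : ∀ m n d .{{_ : NonZero d}} → m ≤ n → length (filter (d ∣?_) (interval m n)) ≡ n / d ∸ m / d
count-multiples m n d m≤n = begin
  length (filter (d ∣?_) (interval m n))            ≡⟨ length-filter≡∑ (d ∣?_) (interval m n) ⟩
  ℕΣ.∑ (interval m n) (λ x → 𝟙 (d ∣? x))           ≡⟨ ℕΣ.∑-map (λ k → suc (m + k)) (upTo (n ∸ m)) _ ⟩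
  ℕΣ.∑ (upTo (n ∸ m)) (λ k → 𝟙 (d ∣? suc (m + k))) ≡⟨ count-from (n ∸ m) ⟩
  (m + (n ∸ m)) / d ∸ m / d                        ≡⟨ cong (λ y → y / d ∸ m / d) (ℕP.m+[n∸m]≡n m≤n) ⟩
  n / d ∸ m / d                                    ∎
  where
  open ≡-Reasoning
  count-from : ∀ k → ℕΣ.∑ (upTo k) (λ i → 𝟙 (d ∣? suc (m + i))) ≡ (m + k) / d ∸ m / d
  count-from zero    = sym (trans (cong (λ y → y / d ∸ m / d) (ℕP.+-identityʳ m)) (ℕP.n∸n≡0 (m / d)))
  count-from (suc k) = begin
    ℕΣ.∑ (upTo (suc k)) (λ i → 𝟙 (d ∣? suc (m + i))) ≡⟨ ℕΣ.∑-upTo-suc k _ ⟩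
    ℕΣ.∑ (upTo k) (λ i → 𝟙 (d ∣? suc (m + i))) + new  ≡⟨ cong (_+ new) (count-from k) ⟩
    ((m + k) / d ∸ m / d) + new                        ≡⟨ ℕP.+-∸-comm new (/-monoˡ-≤ d (ℕP.m≤m+n m k)) ⟨
    ((m + k) / d + new) ∸ m / d                        ≡⟨ cong (_∸ m / d) (suc-/ (m + k) d) ⟨
    suc (m + k) / d ∸ m / d                            ≡⟨ cong (λ y → y / d ∸ m / d) (ℕP.+-suc m k) ⟨
    (m + suc k) / d ∸ m / d                            ∎
    where new = 𝟙 (d ∣? suc (m + k))

count-subsets-divisible-by : ∀ m n d .{{_ : NonZero d}} → m ≤ n →
  ℕΣ.∑ (subsets (interval m n)) (λ A → 𝟙 (d ∣? gcdList A)) ≡ 2 ^ (n / d ∸ m / d)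
count-subsets-divisible-by m n d m≤n =
  trans (count-divisible-subsets d (interval m n)) (cong (2 ^_) (count-multiples m n d m≤n))

prime-divisor : ∀ n → 2 ≤ n → ∃[ p ] Prime p × p ∣ n
prime-divisor 1 (s≤s ())
prime-divisor (suc (suc k)) _ with factorise (suc (suc k))
... | record { factors = [] ; isFactorisation = () }
... | record { factors = p ∷ _ ; isFactorisation = n≡ ; factorsPrime = pp ∷ _ } =
  p , pp , subst (p ∣_) (sym n≡) (m∣m*n _)

prime≥1 : ∀ {p} → Prime p → 1 ≤ p
prime≥1 pp = ℕ.>-nonZero⁻¹ _ {{prime⇒nonZero pp}}

prime∤⇒coprime : ∀ {p n} → Prime p → ¬ p ∣ n → Coprime n p
prime∤⇒coprime {p} pp p∤n {i} (i∣n , i∣p) with prime⇒irreducible pp i∣p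
... | inj₁ i≡1   = i≡1
... | inj₂ refl  = ⊥-elim (p∤n i∣n)

prime∣prime⇒≡ : ∀ {q p} → Prime q → Prime p → q ∣ p → q ≡ p
prime∣prime⇒≡ pq pp q∣p with prime⇒irreducible pp q∣p
... | inj₁ refl = ⊥-elim (ℕ.nonTrivial⇒≢1 {{prime⇒nonTrivial pq}} refl)
... | inj₂ q≡p  = q≡p

-- d has a factor k² with k ≥ 2; `squarefree d` decides the negation of this for d ≥ 1
HasSquareFactor : ℕ → Set
HasSquareFactor d = ∃[ k ] 2 ≤ k × k * k ∣ d

squarefree≡false⇒ : ∀ d → squarefree d ≡ false → HasSquareFactor d
squarefree≡false⇒ d sf
  with j , w ← satisfied (any⁻ _ (upTo d) (Equivalence.from T-≡ (not-injective sf)))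
  = suc (suc j) , s≤s (s≤s z≤n) , toWitness w

⇒squarefree≡false : ∀ d → 1 ≤ d → HasSquareFactor d → squarefree d ≡ false
⇒squarefree≡false d d≥1 (1 , s≤s () , _)
⇒squarefree≡false d d≥1 (suc (suc j) , _ , k²∣d) =
  cong not (Equivalence.to T-≡ (any⁺ _ (lose (∈-upTo⁺ j<d) (fromWitness k²∣d))))
  where
  j<d : j < d
  j<d = ℕP.<-≤-trans (s≤s (ℕP.n≤1+n j)) (ℕP.≤-trans (ℕP.m≤m*n (suc (suc j)) (suc (suc j))) (∣⇒≤ {{ℕ.>-nonZero d≥1}} k²∣d))

squareFactor-prime* : ∀ {p e} → Prime p → ¬ p ∣ e → HasSquareFactor (p * e) → HasSquareFactor e
squareFactor-prime* {p} {e} pp p∤e (k , k≥2 , k²∣pe) with p ∣? k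
... | yes p∣k = ⊥-elim (p∤e (*-cancelˡ-∣ p {{prime⇒nonZero pp}} (∣-trans (*-pres-∣ p∣k p∣k) k²∣pe)))
... | no  p∤k = k , k≥2 , coprime-divisor (prime∤⇒coprime pp p∤k²) k²∣pe
  where
  p∤k² : ¬ p ∣ k * k
  p∤k² p∣k² with euclidsLemma k k pp p∣k²
  ... | inj₁ p∣k = p∤k p∣k
  ... | inj₂ p∣k = p∤k p∣k

squarefree-prime* : ∀ {p e} → Prime p → ¬ p ∣ e → 1 ≤ e → squarefree (p * e) ≡ squarefree e
squarefree-prime* {p} {e} pp p∤e e≥1 with squarefree e in sf-e
... | false = ⇒squarefree≡false (p * e) (ℕP.*-mono-≤ (prime≥1 pp) e≥1)
                (let k , k≥2 , k²∣e = squarefree≡false⇒ e sf-e in k , k≥2 , ∣n⇒∣m*n p k²∣e)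
... | true with squarefree (p * e) in sf-pe
...   | true  = refl
...   | false = impossible
  where
  impossible : false ≡ true
  impossible = trans (sym (⇒squarefree≡false e e≥1 (squareFactor-prime* pp p∤e (squarefree≡false⇒ (p * e) sf-pe)))) sf-e

ω≡∑ : ∀ d N → 1 ≤ d → d ≤ N → ω d ≡ ℕΣ.∑ (upTo N) (λ j → ℕΣ.when (suc j ∣? d) (𝟙 (prime? (suc j))))
ω≡∑ d N d≥1 d≤N = begin
  ω d ≡⟨ length-filter≡∑ (λ j → prime? (suc j)) (filter (λ j → suc j ∣? d) (upTo d)) ⟩
  ℕΣ.∑ (filter (λ j → suc j ∣? d) (upTo d)) (λ j → 𝟙 (prime? (suc j))) ≡⟨ ℕΣ.∑-filter (λ j → suc j ∣? d) (upTo d) _ ⟩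
  ℕΣ.∑ (upTo d) F ≡⟨ ℕΣ.∑-upTo-extend F d≤N beyond-d ⟨
  ℕΣ.∑ (upTo N) F ∎
  where
  open ≡-Reasoning
  F = λ j → ℕΣ.when (suc j ∣? d) (𝟙 (prime? (suc j)))
  beyond-d : ∀ j → d ≤ j → F j ≡ 0
  beyond-d j d≤j = ℕΣ.when-∣-beyond j d≥1 d≤j

∑-𝟙-≡ : ∀ N p → 1 ≤ p → p ≤ N → ℕΣ.∑ (upTo N) (λ j → 𝟙 (suc j ℕ.≟ p)) ≡ 1
∑-𝟙-≡ N (suc p′) _ p≤N = begin
  ℕΣ.∑ (upTo N) F               ≡⟨ ℕΣ.∑-upTo-extend F p≤N (λ j p≤j → ℕΣ.when-no (suc j ℕ.≟ suc p′) (λ e → ℕP.<⇒≢ (s≤s p≤j) (sym e))) ⟩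
  ℕΣ.∑ (upTo (suc p′)) F        ≡⟨ ℕΣ.∑-upTo-suc p′ F ⟩
  ℕΣ.∑ (upTo p′) F + F p′       ≡⟨ cong₂ _+_ (ℕΣ.∑-zero (upTo p′) below-p) (ℕΣ.when-yes (suc p′ ℕ.≟ suc p′) refl) ⟩
  1                             ∎
  where
  open ≡-Reasoning
  F = λ j → 𝟙 (suc j ℕ.≟ suc p′)
  below-p : ∀ j → j ∈ upTo p′ → F j ≡ 0
  below-p j j∈ = ℕΣ.when-no (suc j ℕ.≟ suc p′) (λ e → ℕP.<⇒≢ (∈-upTo⁻ j∈) (ℕP.suc-injective e))

prime-divisors-of-p* : ∀ {p e} → Prime p → ¬ p ∣ e → ∀ q →
  ℕΣ.when (q ∣? p * e) (𝟙 (prime? q)) ≡ ℕΣ.when (q ∣? e) (𝟙 (prime? q)) + 𝟙 (q ℕ.≟ p)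
prime-divisors-of-p* {p} {e} pp p∤e q with q ℕ.≟ p
... | yes refl = begin
  ℕΣ.when (p ∣? p * e) (𝟙 (prime? p)) ≡⟨ ℕΣ.when-yes (p ∣? p * e) (m∣m*n e) ⟩
  𝟙 (prime? p)                        ≡⟨ ℕΣ.when-yes (prime? p) pp ⟩
  1                                   ≡⟨ cong (_+ 1) (ℕΣ.when-no (p ∣? e) p∤e) ⟨
  ℕΣ.when (p ∣? e) (𝟙 (prime? p)) + 1 ∎
  where open ≡-Reasoning
... | no q≢p = trans (other-q (prime? q)) (sym (ℕP.+-identityʳ _))
  where
  other-q : (q? : Dec (Prime q)) → ℕΣ.when (q ∣? p * e) (𝟙 q?) ≡ ℕΣ.when (q ∣? e) (𝟙 q?)
  other-q (no _)   = trans (ℕΣ.when-0 (q ∣? p * e)) (sym (ℕΣ.when-0 (q ∣? e)))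
  other-q (yes pq) = ℕΣ.when-⇔ (q ∣? p * e) (q ∣? e) q∣pe⇒q∣e (∣n⇒∣m*n p)
    where
    q∣pe⇒q∣e : q ∣ p * e → q ∣ e
    q∣pe⇒q∣e q∣pe with euclidsLemma p e pq q∣pe
    ... | inj₁ q∣p = ⊥-elim (q≢p (prime∣prime⇒≡ pq pp q∣p))
    ... | inj₂ q∣e = q∣e

ω-prime* : ∀ {p e} → Prime p → ¬ p ∣ e → 1 ≤ e → ω (p * e) ≡ suc (ω e)
ω-prime* {p} {e} pp p∤e e≥1 = begin
  ω (p * e) ≡⟨ ω≡∑ (p * e) (p * e) pe≥1 ℕP.≤-refl ⟩
  ℕΣ.∑ (upTo (p * e)) (λ j → ℕΣ.when (suc j ∣? p * e) (𝟙 (prime? (suc j))))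
    ≡⟨ ℕΣ.∑-cong (upTo (p * e)) (λ j → prime-divisors-of-p* pp p∤e (suc j)) ⟩
  ℕΣ.∑ (upTo (p * e)) (λ j → ℕΣ.when (suc j ∣? e) (𝟙 (prime? (suc j))) + 𝟙 (suc j ℕ.≟ p))
    ≡⟨ ℕΣ.∑-+ (upTo (p * e)) _ _ ⟩
  ℕΣ.∑ (upTo (p * e)) (λ j → ℕΣ.when (suc j ∣? e) (𝟙 (prime? (suc j)))) + ℕΣ.∑ (upTo (p * e)) (λ j → 𝟙 (suc j ℕ.≟ p))
    ≡⟨ cong₂ _+_ (sym (ω≡∑ e (p * e) e≥1 (ℕP.m≤n*m e p {{prime⇒nonZero pp}}))) (∑-𝟙-≡ (p * e) p (prime≥1 pp) (ℕP.m≤m*n p e {{ℕ.>-nonZero e≥1}})) ⟩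
  ω e + 1 ≡⟨ ℕP.+-comm (ω e) 1 ⟩
  suc (ω e) ∎
  where
  open ≡-Reasoning
  pe≥1 : 1 ≤ p * e
  pe≥1 = ℕP.*-mono-≤ (prime≥1 pp) e≥1

μ-squareFactor : ∀ d → 1 ≤ d → HasSquareFactor d → μ d ≡ ℤ.0ℤ
μ-squareFactor d d≥1 k²∣d = cong (λ b → if b then (ℤ.- ℤ.1ℤ) ℤ.^ ω d else ℤ.0ℤ) (⇒squarefree≡false d d≥1 k²∣d)

μ-prime* : ∀ {p e} → Prime p → ¬ p ∣ e → 1 ≤ e → μ (p * e) ≡ ℤ.- μ e
μ-prime* {p} {e} pp p∤e e≥1 = begin
  μ (p * e)
    ≡⟨ cong₂ (λ b w → if b then (ℤ.- ℤ.1ℤ) ℤ.^ w else ℤ.0ℤ) (squarefree-prime* pp p∤e e≥1) (ω-prime* pp p∤e e≥1) ⟩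
  (if squarefree e then (ℤ.- ℤ.1ℤ) ℤ.^ suc (ω e) else ℤ.0ℤ)
    ≡⟨ one-more-factor (squarefree e) ⟩
  ℤ.- μ e ∎
  where
  open ≡-Reasoning
  one-more-factor : ∀ b → (if b then (ℤ.- ℤ.1ℤ) ℤ.^ suc (ω e) else ℤ.0ℤ)
                          ≡ ℤ.- (if b then (ℤ.- ℤ.1ℤ) ℤ.^ ω e else ℤ.0ℤ)
  one-more-factor true  = ℤP.-1*i≡-i _
  one-more-factor false = refl

module ℤΣ = Sums ℤP.+-*-semiring

∑-neg : {A : Set} (xs : List A) (f : A → ℤ) → ℤΣ.∑ xs (λ x → ℤ.- f x) ≡ ℤ.- ℤΣ.∑ xs f
∑-neg []       f = refl
∑-neg (x ∷ xs) f = trans (cong (λ s → ℤ.- f x ℤ.+ s) (∑-neg xs f)) (sym (ℤP.neg-distrib-+ (f x) _))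

when-neg : {P : Set} (D : Dec P) (x : ℤ) → ℤΣ.when D (ℤ.- x) ≡ ℤ.- ℤΣ.when D x
when-neg (yes _) x = refl
when-neg (no _)  x = refl

∑-divisors : ℕ → ℕ → (ℕ → ℤ) → ℤ
∑-divisors N k f = ℤΣ.∑ (upTo N) (λ j → ℤΣ.when (suc j ∣? k) (f (suc j)))

∑-divisors-bound : ∀ {k N} (f : ℕ → ℤ) → 1 ≤ k → k ≤ N → ∑-divisors N k f ≡ ∑-divisors k k f
∑-divisors-bound {k} f k≥1 k≤N = ℤΣ.∑-upTo-extend _ k≤N (λ j k≤j → ℤΣ.when-∣-beyond j k≥1 k≤j)

p*e∣k : ∀ {p e k} → Prime p → p ∣ k → ¬ p ∣ e → e ∣ k → p * e ∣ k
p*e∣k {p} {e} pp p∣k p∤e (divides t refl) with euclidsLemma t e pp p∣k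
... | inj₁ p∣t = *-pres-∣ p∣t (∣-refl {e})
... | inj₂ p∣e = ⊥-elim (p∤e p∣e)

μ-on-multiples : ∀ {p k} → Prime p → p ∣ k → ∀ e → 1 ≤ e →
  ℤΣ.when (p * e ∣? k) (μ (p * e)) ≡ ℤ.- ℤΣ.when (¬? (p ∣? e)) (ℤΣ.when (e ∣? k) (μ e))
μ-on-multiples {p} {k} pp p∣k e e≥1 with p ∣? e
... | yes p∣e = trans (cong (ℤΣ.when (p * e ∣? k)) (μ-squareFactor (p * e) (ℕP.*-mono-≤ (prime≥1 pp) e≥1)
                        (p , ℕ.nonTrivial⇒n>1 p {{prime⇒nonTrivial pp}} , *-monoʳ-∣ p p∣e)))
                      (ℤΣ.when-0 (p * e ∣? k))
... | no  p∤e = begin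
  ℤΣ.when (p * e ∣? k) (μ (p * e))   ≡⟨ cong (ℤΣ.when (p * e ∣? k)) (μ-prime* pp p∤e e≥1) ⟩
  ℤΣ.when (p * e ∣? k) (ℤ.- μ e)     ≡⟨ ℤΣ.when-⇔ (p * e ∣? k) (e ∣? k) (∣-trans (n∣m*n p)) (p*e∣k pp p∣k p∤e) ⟩
  ℤΣ.when (e ∣? k) (ℤ.- μ e)         ≡⟨ when-neg (e ∣? k) (μ e) ⟩
  ℤ.- ℤΣ.when (e ∣? k) (μ e)         ∎
  where open ≡-Reasoning

-- Σ_{d ∣ k} μ d = 0 for k ≥ 2: with p a prime divisor of k, the divisors p·e cancel the divisors e with p ∤ e
μ-sum-vanishes : ∀ k → 2 ≤ k → ∑-divisors k k μ ≡ ℤ.0ℤ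
μ-sum-vanishes k k≥2 with p , pp , p∣k ← prime-divisor k k≥2 = begin
  ℤΣ.∑ (upTo k) T
    ≡⟨ ∑-divisors-bound μ k≥1 k≤pk ⟨
  ℤΣ.∑ (upTo (p * k)) T
    ≡⟨ ℤΣ.∑-cong (upTo (p * k)) (λ j → ℤΣ.when-split (p ∣? suc j) (T j)) ⟩
  ℤΣ.∑ (upTo (p * k)) (λ j → ℤΣ.when (p ∣? suc j) (T′ (suc j)) ℤ.+ A j)
    ≡⟨ ℤΣ.∑-+ (upTo (p * k)) _ A ⟩
  ℤΣ.∑ (upTo (p * k)) (λ j → ℤΣ.when (p ∣? suc j) (T′ (suc j))) ℤ.+ ℤΣ.∑ (upTo (p * k)) A
    ≡⟨ cong₂ ℤ._+_ (ℤΣ.∑-multiples p k T′) (ℤΣ.∑-upTo-extend A k≤pk (λ j k≤j → A-beyond j k≤j)) ⟩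
  ℤΣ.∑ (upTo k) (λ i → T′ (p * suc i)) ℤ.+ ℤΣ.∑ (upTo k) A
    ≡⟨ cong (ℤ._+ ℤΣ.∑ (upTo k) A) (ℤΣ.∑-cong (upTo k) (λ i → μ-on-multiples pp p∣k (suc i) (s≤s z≤n))) ⟩
  ℤΣ.∑ (upTo k) (λ i → ℤ.- A i) ℤ.+ ℤΣ.∑ (upTo k) A
    ≡⟨ cong (ℤ._+ ℤΣ.∑ (upTo k) A) (∑-neg (upTo k) A) ⟩
  ℤ.- ℤΣ.∑ (upTo k) A ℤ.+ ℤΣ.∑ (upTo k) A
    ≡⟨ ℤP.+-inverseˡ (ℤΣ.∑ (upTo k) A) ⟩
  ℤ.0ℤ ∎
  where
  open ≡-Reasoning
  instance _ = prime⇒nonZero pp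
  T′ : ℕ → ℤ
  T′ d = ℤΣ.when (d ∣? k) (μ d)
  T : ℕ → ℤ
  T j = T′ (suc j)
  A : ℕ → ℤ
  A j = ℤΣ.when (¬? (p ∣? suc j)) (T j)
  k≥1 : 1 ≤ k
  k≥1 = ℕP.≤-trans (s≤s z≤n) k≥2
  k≤pk : k ≤ p * k
  k≤pk = ℕP.m≤n*m k p
  A-beyond : ∀ j → k ≤ j → A j ≡ ℤ.0ℤ
  A-beyond j k≤j = trans (cong (ℤΣ.when (¬? (p ∣? suc j))) (ℤΣ.when-∣-beyond j k≥1 k≤j)) (ℤΣ.when-0 (¬? (p ∣? suc j)))

∑-divisors-μ : ∀ k N → 1 ≤ k → k ≤ N → ∑-divisors N k μ ≡ ℤ.+ 𝟙 (k ℕ.≟ 1)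
∑-divisors-μ k N k≥1 k≤N = trans (∑-divisors-bound μ k≥1 k≤N) (by-size k k≥1)
  where
  by-size : ∀ k → 1 ≤ k → ∑-divisors k k μ ≡ ℤ.+ 𝟙 (k ℕ.≟ 1)
  by-size 1             _ = refl
  by-size (suc (suc k)) _ = μ-sum-vanishes (suc (suc k)) (s≤s (s≤s z≤n))

ℤ-cast-∑ : {A : Set} (xs : List A) (f : A → ℕ) → ℤ.+ ℕΣ.∑ xs f ≡ ℤΣ.∑ xs (λ x → ℤ.+ f x)
ℤ-cast-∑ []       f = refl
ℤ-cast-∑ (x ∷ xs) f = trans (ℤP.pos-+ (f x) (ℕΣ.∑ xs f)) (cong (λ s → ℤ.+ f x ℤ.+ s) (ℤ-cast-∑ xs f))

when≡*𝟙 : {P : Set} (D : Dec P) (c : ℤ) → ℤΣ.when D c ≡ c ℤ.* ℤ.+ 𝟙 D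
when≡*𝟙 (yes _) c = sym (ℤP.*-identityʳ c)
when≡*𝟙 (no _)  c = sym (ℤP.*-zeroʳ c)

∑-when-const : {A : Set} {P : Pred A _} (P? : Decidable P) (xs : List A) (c : ℤ) →
               ℤΣ.∑ xs (λ x → ℤΣ.when (P? x) c) ≡ c ℤ.* ℤ.+ ℕΣ.∑ xs (λ x → 𝟙 (P? x))
∑-when-const P? xs c = begin
  ℤΣ.∑ xs (λ x → ℤΣ.when (P? x) c)         ≡⟨ ℤΣ.∑-cong xs (λ x → when≡*𝟙 (P? x) c) ⟩
  ℤΣ.∑ xs (λ x → c ℤ.* ℤ.+ 𝟙 (P? x))       ≡⟨ ℤΣ.∑-*ˡ xs c _ ⟩
  c ℤ.* ℤΣ.∑ xs (λ x → ℤ.+ 𝟙 (P? x))       ≡⟨ cong (c ℤ.*_) (ℤ-cast-∑ xs _) ⟨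
  c ℤ.* ℤ.+ ℕΣ.∑ xs (λ x → 𝟙 (P? x))       ∎
  where open ≡-Reasoning

sumDiv≡∑-divisors : ∀ n (f : (d : ℕ) → .{{NonZero d}} → ℤ) →
                    sumDiv n f ≡ ℤΣ.∑ (upTo n) (λ j → ℤΣ.when (suc j ∣? n) (f (suc j)))
sumDiv≡∑-divisors n f =
  trans (ℤΣ.foldr-map≡∑ (λ j → f (suc j)) (filter (λ j → suc j ∣? n) (upTo n)))
        (ℤΣ.∑-filter (λ j → suc j ∣? n) (upTo n) (λ j → f (suc j)))

coprime-indicator : ∀ g n → 1 ≤ n → ℤ.+ 𝟙 (coprime? g n) ≡ ∑-divisors n n (λ d → ℤΣ.when (d ∣? g) (μ d))
coprime-indicator g n n≥1 = begin
  ℤ.+ 𝟙 (coprime? g n)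
    ≡⟨ cong ℤ.+_ (ℕΣ.when-⇔ (coprime? g n) (gcd n g ℕ.≟ 1) (λ c → coprime⇒gcd≡1 (Coprimality.sym c))
                                                          (λ e → Coprimality.sym (gcd≡1⇒coprime e))) ⟩
  ℤ.+ 𝟙 (gcd n g ℕ.≟ 1)
    ≡⟨ ∑-divisors-μ (gcd n g) n gcd≥1 (∣⇒≤ {{ℕ.>-nonZero n≥1}} (gcd[m,n]∣m n g)) ⟨
  ∑-divisors n (gcd n g) μ
    ≡⟨ ℤΣ.∑-cong (upTo n) (λ j → ℤΣ.when-∣-gcd (suc j) n g (μ (suc j))) ⟨
  ∑-divisors n n (λ d → ℤΣ.when (d ∣? g) (μ d)) ∎
  where
  open ≡-Reasoning
  gcd≥1 : 1 ≤ gcd n g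
  gcd≥1 = ℕP.n≢0⇒n>0 (λ gcd≡0 → ℕP.<⇒≢ n≥1 (sym (gcd[m,n]≡0⇒m≡0 gcd≡0)))

Φ-formula : ∀ m n → m < n → ℤ.+ Φ m n ≡ sumDiv n (λ d → μ d ℤ.* ℤ.+ (2 ^ (n / d ∸ m / d)))
Φ-formula m n m<n = begin
  ℤ.+ Φ m n
    ≡⟨ cong ℤ.+_ (length-filter≡∑ (λ A → coprime? (gcdList A) n) U) ⟩
  ℤ.+ ℕΣ.∑ U (λ A → 𝟙 (coprime? (gcdList A) n))
    ≡⟨ ℤ-cast-∑ U _ ⟩
  ℤΣ.∑ U (λ A → ℤ.+ 𝟙 (coprime? (gcdList A) n))
    ≡⟨ ℤΣ.∑-cong U (λ A → coprime-indicator (gcdList A) n n≥1) ⟩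
  ℤΣ.∑ U (λ A → ∑-divisors n n (λ d → ℤΣ.when (d ∣? gcdList A) (μ d)))
    ≡⟨ ℤΣ.∑-swap U (upTo n) _ ⟩
  ℤΣ.∑ (upTo n) (λ j → ℤΣ.∑ U (λ A → ℤΣ.when (suc j ∣? n) (ℤΣ.when (suc j ∣? gcdList A) (μ (suc j)))))
    ≡⟨ ℤΣ.∑-cong (upTo n) (λ j → ℤΣ.∑-when (suc j ∣? n) U _) ⟩
  ℤΣ.∑ (upTo n) (λ j → ℤΣ.when (suc j ∣? n) (ℤΣ.∑ U (λ A → ℤΣ.when (suc j ∣? gcdList A) (μ (suc j)))))
    ≡⟨ ℤΣ.∑-cong (upTo n) (λ j → cong (ℤΣ.when (suc j ∣? n)) (count j)) ⟩
  ℤΣ.∑ (upTo n) (λ j → ℤΣ.when (suc j ∣? n) (μ (suc j) ℤ.* ℤ.+ (2 ^ (n / suc j ∸ m / suc j))))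
    ≡⟨ sumDiv≡∑-divisors n (λ d → μ d ℤ.* ℤ.+ (2 ^ (n / d ∸ m / d))) ⟨
  sumDiv n (λ d → μ d ℤ.* ℤ.+ (2 ^ (n / d ∸ m / d))) ∎
  where
  open ≡-Reasoning
  U = subsets (interval m n)
  n≥1 : 1 ≤ n
  n≥1 = ℕP.≤-trans (s≤s z≤n) m<n
  count : ∀ j → ℤΣ.∑ U (λ A → ℤΣ.when (suc j ∣? gcdList A) (μ (suc j))) ≡ μ (suc j) ℤ.* ℤ.+ (2 ^ (n / suc j ∸ m / suc j))
  count j = trans (∑-when-const (λ A → suc j ∣? gcdList A) U (μ (suc j)))
                  (cong (λ c → μ (suc j) ℤ.* ℤ.+ c) (count-subsets-divisible-by m n (suc j) (ℕP.<⇒≤ m<n)))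

quotient-gap : ∀ m k q .{{_ : NonZero q}} → (m + k) / q ∸ m / q ≤ suc (k / q)
quotient-gap m k q = subst (λ x → (x + k) / q ∸ x / q ≤ suc (k / q)) (sym (m≡m%n+[m/n]*n m q))
                           (gap (m % q) (m / q) (m%n<n m q))
  where
  gap : ∀ r a → r < q → ((r + a * q) + k) / q ∸ (r + a * q) / q ≤ suc (k / q)
  gap r a r<q = begin
    ((r + a * q) + k) / q ∸ (r + a * q) / q ≡⟨ cong₂ _∸_ (cong (_/ q) (ℕP.+-assoc r (a * q) k)) ([r+q*d]/d≡q a q r<q) ⟩
    (r + (a * q + k)) / q ∸ a               ≡⟨ cong (λ x → (r + x) / q ∸ a) (ℕP.+-comm (a * q) k) ⟩
    (r + (k + a * q)) / q ∸ a               ≡⟨ cong (λ x → x / q ∸ a) (ℕP.+-assoc r k (a * q)) ⟨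
    ((r + k) + a * q) / q ∸ a               ≡⟨ cong (_∸ a) (+-distrib-/-∣ʳ (r + k) (divides a refl)) ⟩
    ((r + k) / q + a * q / q) ∸ a           ≡⟨ cong (λ x → ((r + k) / q + x) ∸ a) (m*n/n≡m a q) ⟩
    ((r + k) / q + a) ∸ a                   ≡⟨ ℕP.m+n∸n≡m ((r + k) / q) a ⟩
    (r + k) / q                             ≤⟨ /-monoˡ-≤ q (ℕP.+-monoˡ-≤ k (ℕP.<⇒≤ r<q)) ⟩
    (q + k) / q                             ≡⟨ +-distrib-/-∣ˡ k (∣-refl {q}) ⟩
    q / q + k / q                           ≡⟨ cong (_+ k / q) (n/n≡1 q) ⟩
    suc (k / q)                             ∎
    where open ℕP.≤-Reasoning

exponent-bound : ∀ m n q p .{{_ : NonZero q}} → m ≤ n → p < q → n / q ∸ m / q ≤ suc ((n ∸ m) / suc p)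
exponent-bound m n q p m≤n p<q = begin
  n / q ∸ m / q               ≡⟨ cong (λ x → x / q ∸ m / q) (ℕP.m+[n∸m]≡n m≤n) ⟨
  (m + (n ∸ m)) / q ∸ m / q   ≤⟨ quotient-gap m (n ∸ m) q ⟩
  suc ((n ∸ m) / q)           ≤⟨ s≤s (/-monoʳ-≤ (n ∸ m) p<q) ⟩
  suc ((n ∸ m) / suc p)       ∎
  where open ℕP.≤-Reasoning

∑-mono : {A : Set} (xs : List A) {f g : A → ℕ} → (∀ x → f x ≤ g x) → ℕΣ.∑ xs f ≤ ℕΣ.∑ xs g
∑-mono []       f≤g = z≤n
∑-mono (x ∷ xs) f≤g = ℕP.+-mono-≤ (f≤g x) (∑-mono xs f≤g)

term≤∑ : {A : Set} {x : A} (xs : List A) (f : A → ℕ) → x ∈ xs → f x ≤ ℕΣ.∑ xs f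
term≤∑ (y ∷ xs) f (here refl)  = ℕP.m≤m+n (f y) _
term≤∑ (y ∷ xs) f (there x∈xs) = ℕP.≤-trans (term≤∑ xs f x∈xs) (ℕP.m≤n+m _ (f y))

∑-const : {A : Set} (xs : List A) (c : ℕ) → ℕΣ.∑ xs (λ _ → c) ≡ length xs * c
∑-const []       c = refl
∑-const (x ∷ xs) c = cong (c +_) (∑-const xs c)

𝟙-mono : {P Q : Set} (P? : Dec P) (Q? : Dec Q) → (P → Q) → 𝟙 P? ≤ 𝟙 Q?
𝟙-mono (yes p) Q? p→q = ℕP.≤-reflexive (sym (ℕΣ.when-yes Q? (p→q p)))
𝟙-mono (no _)  Q? p→q = z≤n

𝟙-complement : {P : Set} (D : Dec P) → 𝟙 D + 𝟙 (¬? D) ≡ 1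
𝟙-complement (yes _) = refl
𝟙-complement (no _)  = refl

OtherPrimeDivisor : ℕ → ℕ → ℕ → Set
OtherPrimeDivisor p n q = Prime q × q ∣ n × ¬ q ≡ p

other-prime-divisor? : ∀ p n q → Dec (OtherPrimeDivisor p n q)
other-prime-divisor? p n q = prime? q ×-dec q ∣? n ×-dec ¬? (q ℕ.≟ p)

common-prime-divisor : ∀ g n → 1 ≤ n → ¬ Coprime g n → ∃[ q ] Prime q × q ∣ g × q ∣ n
common-prime-divisor g n n≥1 ¬cop =
  let q , q-prime , q∣gcd = prime-divisor (gcd g n) gcd≥2
  in  q , q-prime , ∣-trans q∣gcd (gcd[m,n]∣m g n) , ∣-trans q∣gcd (gcd[m,n]∣n g n)
  where
  gcd≥2 : 2 ≤ gcd g n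
  gcd≥2 with gcd g n in gcd≡
  ... | 0             = ⊥-elim (ℕP.<⇒≢ n≥1 (sym (gcd[m,n]≡0⇒n≡0 g gcd≡)))
  ... | 1             = ⊥-elim (¬cop (gcd≡1⇒coprime gcd≡))
  ... | suc (suc _)   = s≤s (s≤s z≤n)

not-coprime⇒prime-divisor : ∀ p g n → 1 ≤ n → ¬ Coprime g n →
  1 ≤ 𝟙 (p ∣? g) + ℕΣ.∑ (upTo n) (λ j → ℕΣ.when (other-prime-divisor? p n (suc j)) (𝟙 (suc j ∣? g)))
not-coprime⇒prime-divisor p g n n≥1 ¬cop with common-prime-divisor g n n≥1 ¬cop | p ∣? g
... | _ , _ , _ , _                 | yes _   = s≤s z≤n
... | zero , q-prime , _ , _        | no  _   = ⊥-elim (ℕ.≢-nonZero⁻¹ 0 {{prime⇒nonZero q-prime}} refl)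
... | suc j , q-prime , q∣g , q∣n   | no  p∤g =
  ℕP.≤-trans (ℕP.≤-reflexive (sym q-term)) (term≤∑ (upTo n) F (∈-upTo⁺ (∣⇒≤ {{ℕ.>-nonZero n≥1}} q∣n)))
  where
  F = λ j → ℕΣ.when (other-prime-divisor? p n (suc j)) (𝟙 (suc j ∣? g))
  q-term : F j ≡ 1
  q-term = trans (ℕΣ.when-yes (other-prime-divisor? p n (suc j)) (q-prime , q∣n , λ q≡p → p∤g (subst (_∣ g) q≡p q∣g)))
                 (ℕΣ.when-yes (suc j ∣? g) q∣g)

Ψ : ℕ → ℕ → ℕ
Ψ m n = ℕΣ.∑ (subsets (interval m n)) (λ A → 𝟙 (¬? (coprime? (gcdList A) n)))

Φ+Ψ : ∀ m n → Φ m n + Ψ m n ≡ 2 ^ (n ∸ m)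
Φ+Ψ m n = begin
  Φ m n + Ψ m n
    ≡⟨ cong (_+ Ψ m n) (length-filter≡∑ (λ A → coprime? (gcdList A) n) U) ⟩
  ℕΣ.∑ U (λ A → 𝟙 (coprime? (gcdList A) n)) + Ψ m n
    ≡⟨ ℕΣ.∑-+ U _ _ ⟨
  ℕΣ.∑ U (λ A → 𝟙 (coprime? (gcdList A) n) + 𝟙 (¬? (coprime? (gcdList A) n)))
    ≡⟨ ℕΣ.∑-cong U (λ A → 𝟙-complement (coprime? (gcdList A) n)) ⟩
  ℕΣ.∑ U (λ _ → 1)
    ≡⟨ trans (∑-const U 1) (ℕP.*-identityʳ (length U)) ⟩
  length U
    ≡⟨ length-subsets (interval m n) ⟩
  2 ^ length (interval m n)
    ≡⟨ cong (2 ^_) (trans (length-map _ (upTo (n ∸ m))) (length-upTo (n ∸ m))) ⟩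
  2 ^ (n ∸ m) ∎
  where
  open ≡-Reasoning
  U = subsets (interval m n)

-- a subset whose gcd is divisible by a prime divisor p of n is counted by Ψ
Ψ-lower : ∀ m n p .{{_ : NonZero p}} → m ≤ n → Prime p → p ∣ n → 2 ^ (n / p ∸ m / p) ≤ Ψ m n
Ψ-lower m n p m≤n pp p∣n = begin
  2 ^ (n / p ∸ m / p)                        ≡⟨ count-subsets-divisible-by m n p m≤n ⟨
  ℕΣ.∑ U (λ A → 𝟙 (p ∣? gcdList A))         ≤⟨ ∑-mono U (λ A → 𝟙-mono (p ∣? gcdList A) (¬? (coprime? (gcdList A) n)) (p∣⇒¬coprime (gcdList A))) ⟩
  Ψ m n                                      ∎
  where
  open ℕP.≤-Reasoning
  U = subsets (interval m n)
  p∣⇒¬coprime : ∀ g → p ∣ g → ¬ Coprime g n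
  p∣⇒¬coprime g p∣g cop = ℕ.nonTrivial⇒≢1 {{prime⇒nonTrivial pp}} (cop (p∣g , p∣n))

-- a subset counted by Ψ has its gcd divisible by p or by a larger prime q ∣ n; there are at most n such q,
-- each dividing the gcd of at most 2 ^ (1 + (n - m)/(p + 1)) subsets
Ψ-upper : ∀ m n p .{{_ : NonZero p}} → m < n → ((q : ℕ) → Prime q → q ∣ n → p ≤ q) →
          Ψ m n ≤ 2 ^ (n / p ∸ m / p) + 2 * n * 2 ^ ((n ∸ m) / suc p)
Ψ-upper m n p m<n p-least = begin
  Ψ m n
    ≤⟨ ∑-mono U (λ A → covered (gcdList A)) ⟩
  ℕΣ.∑ U (λ A → 𝟙 (p ∣? gcdList A) + ℕΣ.∑ (upTo n) (λ j → ℕΣ.when (opd? j) (𝟙 (suc j ∣? gcdList A))))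
    ≡⟨ ℕΣ.∑-+ U _ _ ⟩
  ℕΣ.∑ U (λ A → 𝟙 (p ∣? gcdList A)) + ℕΣ.∑ U (λ A → ℕΣ.∑ (upTo n) (λ j → ℕΣ.when (opd? j) (𝟙 (suc j ∣? gcdList A))))
    ≡⟨ cong₂ _+_ (count-subsets-divisible-by m n p m≤n) (ℕΣ.∑-swap U (upTo n) _) ⟩
  P + ℕΣ.∑ (upTo n) (λ j → ℕΣ.∑ U (λ A → ℕΣ.when (opd? j) (𝟙 (suc j ∣? gcdList A))))
    ≡⟨ cong (P +_) (ℕΣ.∑-cong (upTo n) (λ j → trans (ℕΣ.∑-when (opd? j) U _)
                                                    (cong (ℕΣ.when (opd? j)) (count-subsets-divisible-by m n (suc j) m≤n)))) ⟩
  P + ℕΣ.∑ (upTo n) (λ j → ℕΣ.when (opd? j) (2 ^ (n / suc j ∸ m / suc j)))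
    ≤⟨ ℕP.+-monoʳ-≤ P (∑-mono (upTo n) other-divisor-term) ⟩
  P + ℕΣ.∑ (upTo n) (λ _ → 2 * 2 ^ E)
    ≡⟨ cong (P +_) (trans (∑-const (upTo n) _) (cong (_* (2 * 2 ^ E)) (length-upTo n))) ⟩
  P + n * (2 * 2 ^ E)
    ≡⟨ cong (P +_) (trans (sym (ℕP.*-assoc n 2 (2 ^ E))) (cong (_* 2 ^ E) (ℕP.*-comm n 2))) ⟩
  P + 2 * n * 2 ^ E ∎
  where
  open ℕP.≤-Reasoning
  U = subsets (interval m n)
  P = 2 ^ (n / p ∸ m / p)
  E = (n ∸ m) / suc p
  m≤n = ℕP.<⇒≤ m<n
  opd? = λ j → other-prime-divisor? p n (suc j)
  covered : ∀ g → 𝟙 (¬? (coprime? g n)) ≤ 𝟙 (p ∣? g) + ℕΣ.∑ (upTo n) (λ j → ℕΣ.when (opd? j) (𝟙 (suc j ∣? g)))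
  covered g with coprime? g n
  ... | yes _   = z≤n
  ... | no ¬cop = not-coprime⇒prime-divisor p g n (ℕP.≤-trans (s≤s z≤n) m<n) ¬cop
  other-divisor-term : ∀ j → ℕΣ.when (opd? j) (2 ^ (n / suc j ∸ m / suc j)) ≤ 2 * 2 ^ E
  other-divisor-term j with opd? j
  ... | no _                        = z≤n
  ... | yes (q-prime , q∣n , q≢p)   =
    ℕP.^-monoʳ-≤ 2 (exponent-bound m n (suc j) p m≤n (ℕP.≤∧≢⇒< (p-least (suc j) q-prime q∣n) (λ p≡q → q≢p (sym p≡q))))

integer-difference : ∀ a b c → c ≤ b → ℤ.+ (a + b) ℤ.- ℤ.+ c ℤ.- ℤ.+ a ≡ ℤ.+ (b ∸ c)
integer-difference a b c c≤b = begin
  ℤ.+ (a + b) ℤ.- ℤ.+ c ℤ.- ℤ.+ a         ≡⟨ cong (λ x → x ℤ.- ℤ.+ c ℤ.- ℤ.+ a) (ℤP.pos-+ a b) ⟩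
  (ℤ.+ a ℤ.+ ℤ.+ b) ℤ.- ℤ.+ c ℤ.- ℤ.+ a   ≡⟨ cancel-a (ℤ.+ a) (ℤ.+ b) (ℤ.+ c) ⟩
  ℤ.+ b ℤ.- ℤ.+ c                         ≡⟨ ℤP.m-n≡m⊖n b c ⟩
  b ℤ.⊖ c                                 ≡⟨ ℤP.⊖-≥ c≤b ⟩
  ℤ.+ (b ∸ c)                             ∎
  where
  open ≡-Reasoning
  cancel-a : ∀ x y z → (x ℤ.+ y) ℤ.- z ℤ.- x ≡ y ℤ.- z
  cancel-a = solve-∀

open import Data.Integer using (+_)

Φ-estimate : ∀ m n p .{{_ : NonZero p}} → m < n → Prime p → p ∣ n → ((q : ℕ) → Prime q → q ∣ n → p ≤ q) →
  let D = + (2 ^ (n ∸ m)) ℤ.- + (2 ^ (n / p ∸ m / p)) ℤ.- + Φ m n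
  in  (ℤ.0ℤ ℤ.≤ D) × (D ℤ.≤ + (2 * n * 2 ^ ((n ∸ m) / suc p)))
Φ-estimate m n p m<n pp p∣n p-least = subst Bounded (sym difference) (ℤ.+≤+ z≤n , ℤ.+≤+ Ψ-P≤)
  where
  Bounded : ℤ → Set
  Bounded D = (ℤ.0ℤ ℤ.≤ D) × (D ℤ.≤ + (2 * n * 2 ^ ((n ∸ m) / suc p)))
  P = 2 ^ (n / p ∸ m / p)
  difference : + (2 ^ (n ∸ m)) ℤ.- + P ℤ.- + Φ m n ≡ + (Ψ m n ∸ P)
  difference = trans (cong (λ t → + t ℤ.- + P ℤ.- + Φ m n) (sym (Φ+Ψ m n)))
                     (integer-difference (Φ m n) (Ψ m n) P (Ψ-lower m n p (ℕP.<⇒≤ m<n) pp p∣n))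
  Ψ-P≤ : Ψ m n ∸ P ≤ 2 * n * 2 ^ ((n ∸ m) / suc p)
  Ψ-P≤ = ℕP.m≤n+o⇒m∸n≤o (Ψ m n) P (Ψ-upper m n p m<n p-least)

theorem3 : (m n : ℕ) → m < n →
    (+ Φ m n ≡ sumDiv n (λ d → μ d ℤ.* + (2 ^ (n / d ∸ m / d))))
    × (2 ≤ n → (p : ℕ) → (pp : Prime p) → p ∣ n → ((q : ℕ) → Prime q → q ∣ n → p ≤ q) →
        (ℤ.0ℤ ℤ.≤ + (2 ^ (n ∸ m)) ℤ.- + (2 ^ (_/_ n p {{prime⇒nonZero pp}} ∸ _/_ m p {{prime⇒nonZero pp}})) ℤ.- + Φ m n)
        × (+ (2 ^ (n ∸ m)) ℤ.- + (2 ^ (_/_ n p {{prime⇒nonZero pp}} ∸ _/_ m p {{prime⇒nonZero pp}})) ℤ.- + Φ m n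
             ℤ.≤ + (2 * n * 2 ^ ((n ∸ m) / suc p))))
theorem3 m n m<n =
  Φ-formula m n m<n ,
  λ _ p pp p∣n p-least → Φ-estimate m n p {{prime⇒nonZero pp}} m<n pp p∣n p-least
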